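{- Let $\mathcal{A}$ be a finite alphabet, $k$ a positive integer, $\sigma:\mathcal{A}^k\to\mathcal{A}^k$ a cycle, and $v\in\mathcal{A}^k$. Let $s=\sigma^0(v)\sigma^1(v)\cdots\sigma^{|\mathcal{A}|^k-1}(v)$ (concatenation). Then the necklace $[s]$ is $(k,k)$-perfect if and only if for every $\ell$ with $0\le\ell<k$, every $x\in\mathcal{A}^\ell$ and every $y\in\mathcal{A}^{k-\ell}$, there is a unique $w\in\mathcal{A}^k$ such that $w(k-\ell\ldots k-1)=x$ and $\sigma(w)(0\ldots k-\ell-1)=y$.
   Context: A bijection $\sigma:\mathcal{A}^k\to\mathcal{A}^k$ is a cycle if for each $w\in\mathcal{A}^k$ the set $\{\sigma^j(w):0\le j<|\mathcal{A}|^k\}$ equals $\mathcal{A}^k$. Positions in a word are numbered from $0$; $w(i\ldots j)$ denotes the subword of $w$ from position $i$ to position $j$ (empty if $j<i$). A necklace is the equivalence class of a word under cyclic rotations; a word $u$ of length $k$ occurs in $[s]$ ($|s|=N$) at position $i$ if $s((i+t)\bmod N)=u(t)$ for $0\le t<k$. A necklace is $(k,k)$-perfect if it has length $k|\mathcal{A}|^k$ and each word of length $k$ occurs in it exactly $k$ times at positions pairwise different modulo $k$. -}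

module Defs where

import Data.Nat.Properties
open import Data.Nat using (ℕ; zero; suc; _+_; _*_; _^_; _<_; NonZero)
open import Data.Nat.DivMod using (_/_; _%_)
open import Data.Fin using (Fin; toℕ)
open import Data.Vec using (Vec; lookup)
open import Data.Product using (Σ; _×_)
open import Relation.Binary.PropositionalEquality using (_≡_; _≢_)
open import Relation.Nullary using (¬_)

Word : ℕ → ℕ → Set
Word q k = Vec (Fin q) k

iter : {A : Set} → (A → A) → ℕ → A → A
iter f zero x = x
iter f (suc n) x = f (iter f n x)

IsBijection : {A : Set} → (A → A) → Set
IsBijection {A} f = Σ (A → A) λ g → (∀ x → g (f x) ≡ x) × (∀ x → f (g x) ≡ x)

IsCycle : (q k : ℕ) → (Word q k → Word q k) → Set
IsCycle q k σ = IsBijection σ ×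
  (∀ (w u : Word q k) → Σ ℕ λ j → (j < q ^ k) × (iter σ j w ≡ u))

-- s = σ^0(v) σ^1(v) ... σ^{q^k - 1}(v), given as a function on positions
-- (position j, j < k * q^k, holds letter (j mod k) of σ^{j div k}(v)).
-- Positions outside the range are never used (all indices are reduced mod N).
cycleWord : (q k : ℕ) .{{_ : NonZero k}} → (Word q k → Word q k) → Word q k → ℕ → Fin q
cycleWord q k σ v j = lookup (iter σ (j / k) v) (Data.Fin.fromℕ< (Data.Nat.DivMod.m%n<n j k))

OccursAt : {q k : ℕ} (N : ℕ) .{{_ : NonZero N}} → (ℕ → Fin q) → Word q k → ℕ → Set
OccursAt {q} {k} N s u i = ∀ (t : Fin k) → s ((i + toℕ t) % N) ≡ lookup u t

-- A necklace [s] of length N = k q^k is (k,k)-perfect: every word u of length k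
-- occurs exactly k times, at positions pairwise different modulo k.
-- (The length condition holds by construction, N = k * q^k.)
-- "exactly k times at positions pairwise different mod k": there is an
-- enumeration f : Fin k → positions of all occurrences, with pairwise distinct
-- residues mod k (hence the k positions are distinct), and every occurrence is among them.
KKPerfect : (q k N : ℕ) .{{_ : NonZero k}} .{{_ : NonZero N}} → (ℕ → Fin q) → Set
KKPerfect q k N s = ∀ (u : Word q k) → Σ (Fin k → Fin N) λ f →
    (∀ a → OccursAt N s u (toℕ (f a)))
  × (∀ a b → a ≢ b → toℕ (f a) % k ≢ toℕ (f b) % k)
  × (∀ (i : Fin N) → OccursAt N s u (toℕ i) → Σ (Fin k) λ a → f a ≡ i)

∃!′ : (A : Set) → (A → Set) → Set
∃!′ A P = Σ A λ a → P a × (∀ b → P b → b ≡ a)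

SuffixIs : {q k ℓ : ℕ} → Word q k → Vec (Fin q) ℓ → Set
SuffixIs {q} {k} {ℓ} w x = ∀ (t : Fin ℓ) (p : (k Data.Nat.∸ ℓ) + toℕ t < k) →
  lookup w (Data.Fin.fromℕ< p) ≡ lookup x t

PrefixIs : {q k m : ℕ} → Word q k → Vec (Fin q) m → Set
PrefixIs {q} {k} {m} w y = ∀ (t : Fin m) (p : toℕ t < k) →
  lookup w (Data.Fin.fromℕ< p) ≡ lookup y t

-- length of the necklace [s]: k · |A|^k, with |A| = suc p, k = suc k'
necklaceLength : ℕ → ℕ → ℕ
necklaceLength p k = suc k * suc p ^ suc k

PerfectNecklaceOfCycle : (p k : ℕ) → (Word (suc p) (suc k) → Word (suc p) (suc k)) → Word (suc p) (suc k) → Set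
PerfectNecklaceOfCycle p k σ v =
  KKPerfect (suc p) (suc k) (necklaceLength p k)
    {{_}} {{Data.Nat.Properties.m*n≢0 (suc k) (suc p ^ suc k) {{_}} {{Data.Nat.Properties.m^n≢0 (suc p) (suc k)}}}}
    (cycleWord (suc p) (suc k) σ v)

module Submission where

-- Notation: q = |A| is the alphabet size, K = k the word length (suc p and
-- suc k in the formal statement), Q = q^K, N = K·Q, and c is the necklace word s
-- read periodically: c (b·K + j) is letter j of σ^b(v) for j < K.
--
-- Cut the positions of c into the K residue classes mod K.  The
-- window of length K starting at position b·K + a straddles the blocks σ^b(v)
-- and σ^(b+1)(v): it consists of the last ℓ = K - a letters of σ^b(v) followed
-- by the first K - ℓ letters of σ(σ^b(v)).  Hence
--   (1) [s] is (k,k)-perfect  ⇔  every word occurs in every residue class a < K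
--       at exactly one block b < Q  (the k occurrences have distinct residues);
--   (2) "u = x y occurs in class K - ℓ at block b"  ⇔  "w = σ^b(v) has suffix x
--       and σ(w) has prefix y", and since σ is a cycle, b ↦ σ^b(v) is a bijection
--       from {0,…,Q-1} onto the words, so (1) is the paper's unique-w condition.
-- The boundary cases (class a = 0, condition at ℓ = 0) hold for every cycle.

open import Defs
open import Data.Nat using (ℕ; zero; suc; _+_; _*_; _∸_; _^_; _≤_; _<_; z≤n; s≤s; NonZero)
open import Data.Nat.Properties
open import Data.Nat.DivMod
open import Data.Nat.Divisibility using (divides; m∣m*n)
open import Data.Fin using (Fin; toℕ; fromℕ<; punchOut)
open import Data.Fin.Properties using (toℕ<n; toℕ-fromℕ<; fromℕ<-toℕ; toℕ-injective; injective⇒≤; punchOut-injective; any?) renaming (_≟_ to _≟ᶠ_)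
open import Data.Vec using (Vec; lookup; tabulate)
open import Data.Vec.Properties using (tabulate∘lookup; tabulate-cong; lookup∘tabulate)
open import Data.Vec.Recursive using (Fin[m^n]↔Fin[m]^n)
open import Data.Vec.Recursive.Properties using (↔Vec)
open import Data.Product using (Σ; _×_; _,_; proj₁; proj₂; ∃)
open import Data.Product.Function.NonDependent.Propositional using (_×-⇔_)
open import Data.Empty using (⊥-elim)
open import Function.Base using (_∘_)
open import Function.Bundles using (_⇔_; mk⇔; Equivalence; _↣_; Injection)
open import Function.Definitions using (Injective)
open import Function.Properties.Equivalence using () renaming (sym to ⇔-sym)
open import Function.Properties.Inverse using (↔-trans; ↔⇒↣)
open import Relation.Binary.Definitions using (tri<; tri≈; tri>)
open import Relation.Binary.PropositionalEquality
open import Relation.Nullary using (yes; no)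

open Equivalence using (to; from)

vec-ext : ∀ {A : Set} {n} (xs ys : Vec A n) → (∀ i → lookup xs i ≡ lookup ys i) → xs ≡ ys
vec-ext xs ys same = trans (sym (tabulate∘lookup xs)) (trans (tabulate-cong same) (tabulate∘lookup ys))

-- The entry of a vector at a natural-number index known to be in range.
-- (The range proof is irrelevant, so `at` depends on the index only.)
at : ∀ {A : Set} {n} → Vec A n → (j : ℕ) → .(j < n) → A
at xs j j<n = lookup xs (fromℕ< j<n)

at-cong : ∀ {A : Set} {n} (xs : Vec A n) {i j} (i≡j : i ≡ j) .(j<n : j < n) →
          at xs i (subst (_< n) (sym i≡j) j<n) ≡ at xs j j<n
at-cong xs refl _ = refl

at-toℕ : ∀ {A : Set} {n} (xs : Vec A n) (t : Fin n) → at xs (toℕ t) (toℕ<n t) ≡ lookup xs t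
at-toℕ xs t = cong (lookup xs) (fromℕ<-toℕ t (toℕ<n t))

iter-+ : ∀ {A : Set} (f : A → A) m n x → iter f (m + n) x ≡ iter f m (iter f n x)
iter-+ f zero    n x = refl
iter-+ f (suc m) n x = cong f (iter-+ f m n x)

words-embedding : ∀ q n → Fin (q ^ n) ↣ Vec (Fin q) n
words-embedding q n = ↔⇒↣ (↔-trans (Fin[m^n]↔Fin[m]^n q n) (↔Vec n))

injective⇒surjective : ∀ {n} (f : Fin n → Fin n) → Injective _≡_ _≡_ f → ∀ r → ∃ λ x → f x ≡ r
injective⇒surjective {suc n} f f-injective r with any? (λ x → f x ≟ᶠ r)
... | yes hit = hit
... | no miss = ⊥-elim (<-irrefl refl (injective⇒≤ {f = avoid} avoid-injective))
  where
  -- f misses r, so it factors injectively through Fin n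
  avoid : Fin (suc n) → Fin n
  avoid x = punchOut {i = r} (λ r≡fx → miss (x , sym r≡fx))
  avoid-injective : Injective _≡_ _≡_ avoid
  avoid-injective eq = f-injective (punchOut-injective {i = r} _ _ eq)

module Residues (K : ℕ) .{{_ : NonZero K}} (f : Fin K → ℕ)
                (distinct : ∀ x y → x ≢ y → f x % K ≢ f y % K) where

  residue-injective : ∀ {x y} → f x % K ≡ f y % K → x ≡ y
  residue-injective {x} {y} eq with x ≟ᶠ y
  ... | yes x≡y = x≡y
  ... | no x≢y = ⊥-elim (distinct x y x≢y eq)

  residue-cover : ∀ {a} → a < K → ∃ λ x → f x % K ≡ a
  residue-cover {a} a<K = x , trans (sym (toℕ-fromℕ< (m%n<n (f x) K)))
                                    (trans (cong toℕ hits-a) (toℕ-fromℕ< a<K))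
    where
    residue-map : Fin K → Fin K
    residue-map x = fromℕ< (m%n<n (f x) K)
    residue-map-injective : Injective _≡_ _≡_ residue-map
    residue-map-injective {x} {y} eq = residue-injective
      (trans (sym (toℕ-fromℕ< (m%n<n (f x) K))) (trans (cong toℕ eq) (toℕ-fromℕ< (m%n<n (f y) K))))
    x : Fin K
    x = proj₁ (injective⇒surjective residue-map residue-map-injective (fromℕ< a<K))
    hits-a : residue-map x ≡ fromℕ< a<K
    hits-a = proj₂ (injective⇒surjective residue-map residue-map-injective (fromℕ< a<K))

module Blocks (K : ℕ) .{{_ : NonZero K}} where

  block-quotient : ∀ b {j} → j < K → (b * K + j) / K ≡ b
  block-quotient b {j} j<K = begin
    (b * K + j) / K   ≡⟨ +-distrib-/-∣ˡ j (divides b refl) ⟩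
    b * K / K + j / K ≡⟨ cong₂ _+_ (m*n/n≡m b K) (m<n⇒m/n≡0 j<K) ⟩
    b + 0             ≡⟨ +-identityʳ b ⟩
    b                 ∎
    where open ≡-Reasoning

  block-remainder : ∀ b {j} → j < K → (b * K + j) % K ≡ j
  block-remainder b {j} j<K = trans (%-remove-+ˡ j (divides b refl)) (m<n⇒m%n≡m j<K)

  div-mod-split : ∀ n → n ≡ n / K * K + n % K
  div-mod-split n = trans (m≡m%n+[m/n]*n n K) (+-comm (n % K) _)

  position-bound : ∀ {Q b j} → b < Q → j < K → b * K + j < K * Q
  position-bound {Q} {b} b<Q j<K = <-≤-trans (+-monoʳ-< (b * K) j<K)
    (subst (_≤ K * Q) (+-comm K (b * K)) (subst (suc b * K ≤_) (*-comm Q K) (*-monoˡ-≤ K b<Q)))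

  block-bound : ∀ {Q n} → n < K * Q → n / K < Q
  block-bound {Q} {n} n<KQ = m<n*o⇒m/o<n (subst (n <_) (*-comm K Q) n<KQ)

  next-block : ∀ b {ℓ} j → ℓ ≤ K → b * K + (K ∸ ℓ) + (ℓ + j) ≡ suc b * K + j
  next-block b {ℓ} j ℓ≤K = begin
    b * K + (K ∸ ℓ) + (ℓ + j) ≡⟨ +-assoc (b * K) (K ∸ ℓ) (ℓ + j) ⟩
    b * K + (K ∸ ℓ + (ℓ + j)) ≡⟨ cong (b * K +_) (sym (+-assoc (K ∸ ℓ) ℓ j)) ⟩
    b * K + (K ∸ ℓ + ℓ + j)   ≡⟨ cong (λ n → b * K + (n + j)) (m∸n+n≡m ℓ≤K) ⟩
    b * K + (K + j)           ≡⟨ sym (+-assoc (b * K) K j) ⟩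
    b * K + K + j             ≡⟨ cong (_+ j) (+-comm (b * K) K) ⟩
    suc b * K + j             ∎
    where open ≡-Reasoning

suffix-fits : ∀ {ℓ K} → ℓ ≤ K → K ∸ ℓ + ℓ ≤ K
suffix-fits ℓ≤K = ≤-reflexive (m∸n+n≡m ℓ≤K)

back-fits : ∀ {ℓ K} → ℓ ≤ K → ℓ + (K ∸ ℓ) ≤ K
back-fits ℓ≤K = ≤-reflexive (m+[n∸m]≡n ℓ≤K)

module Slices {A : Set} {K : ℕ} where

  slice : (i m : ℕ) → i + m ≤ K → Vec A K → Vec A m
  slice i m i+m≤K w = tabulate (λ t → at w (i + toℕ t) (<-≤-trans (+-monoʳ-< i (toℕ<n t)) i+m≤K))

  at-slice : ∀ {i m} (i+m≤K : i + m ≤ K) w j .(j<m : j < m) →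
             at (slice i m i+m≤K w) j j<m ≡ at w (i + j) (<-≤-trans (+-monoʳ-< i j<m) i+m≤K)
  at-slice {i} i+m≤K w j j<m =
    trans (lookup∘tabulate _ (fromℕ< j<m)) (at-cong w (cong (i +_) (toℕ-fromℕ< j<m)) _)

  slice≡⇔ : ∀ {i m} (i+m≤K : i + m ≤ K) (w : Vec A K) (x : Vec A m) →
            slice i m i+m≤K w ≡ x ⇔ (∀ t (p : i + toℕ t < K) → at w (i + toℕ t) p ≡ lookup x t)
  slice≡⇔ {i} {m} i+m≤K w x = mk⇔
    (λ eq t _ → trans (sym (at-slice i+m≤K w (toℕ t) (toℕ<n t)))
                      (trans (at-toℕ (slice i m i+m≤K w) t) (cong (λ z → lookup z t) eq)))
    (λ agree → vec-ext _ x λ t →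
       trans (lookup∘tabulate _ t) (agree t (<-≤-trans (+-monoʳ-< i (toℕ<n t)) i+m≤K)))

  join-letter : (ℓ : ℕ) → Vec A ℓ → Vec A (K ∸ ℓ) → Fin K → A
  join-letter ℓ x y t with toℕ t <? ℓ
  ... | yes t<ℓ = at x (toℕ t) t<ℓ
  ... | no t≮ℓ = at y (toℕ t ∸ ℓ) (∸-monoˡ-< (toℕ<n t) (≮⇒≥ t≮ℓ))

  join : (ℓ : ℕ) → Vec A ℓ → Vec A (K ∸ ℓ) → Vec A K
  join ℓ x y = tabulate (join-letter ℓ x y)

  lookup-join-front : ∀ ℓ x y (t : Fin K) (t<ℓ : toℕ t < ℓ) → lookup (join ℓ x y) t ≡ at x (toℕ t) t<ℓ
  lookup-join-front ℓ x y t t<ℓ with toℕ t <? ℓ | lookup∘tabulate (join-letter ℓ x y) t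
  ... | yes _  | eq = eq
  ... | no t≮ℓ | _  = ⊥-elim (t≮ℓ t<ℓ)

  lookup-join-back : ∀ ℓ x y (t : Fin K) (ℓ≤t : ℓ ≤ toℕ t) →
                     lookup (join ℓ x y) t ≡ at y (toℕ t ∸ ℓ) (∸-monoˡ-< (toℕ<n t) ℓ≤t)
  lookup-join-back ℓ x y t ℓ≤t with toℕ t <? ℓ | lookup∘tabulate (join-letter ℓ x y) t
  ... | yes t<ℓ | _  = ⊥-elim (<⇒≱ t<ℓ ℓ≤t)
  ... | no _    | eq = eq

  module Cut {ℓ : ℕ} (ℓ≤K : ℓ ≤ K) where

    front : Vec A K → Vec A ℓ
    front = slice 0 ℓ ℓ≤K

    back : Vec A K → Vec A (K ∸ ℓ)
    back = slice ℓ (K ∸ ℓ) (back-fits ℓ≤K)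

    suffix : Vec A K → Vec A ℓ
    suffix = slice (K ∸ ℓ) ℓ (suffix-fits ℓ≤K)

    prefix : Vec A K → Vec A (K ∸ ℓ)
    prefix = slice 0 (K ∸ ℓ) (m∸n≤m K ℓ)

    front-join : ∀ x y → front (join ℓ x y) ≡ x
    front-join x y = from (slice≡⇔ ℓ≤K (join ℓ x y) x) λ t p →
      let t<ℓ = subst (_< ℓ) (sym (toℕ-fromℕ< p)) (toℕ<n t)
      in trans (lookup-join-front ℓ x y (fromℕ< p) t<ℓ)
               (trans (at-cong x (toℕ-fromℕ< p) (toℕ<n t)) (at-toℕ x t))

    back-join : ∀ x y → back (join ℓ x y) ≡ y
    back-join x y = from (slice≡⇔ (back-fits ℓ≤K) (join ℓ x y) y) λ t p →
      let ℓ≤t = subst (ℓ ≤_) (sym (toℕ-fromℕ< p)) (m≤m+n ℓ (toℕ t))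
      in trans (lookup-join-back ℓ x y (fromℕ< p) ℓ≤t)
               (trans (at-cong y (trans (cong (_∸ ℓ) (toℕ-fromℕ< p)) (m+n∸m≡n ℓ (toℕ t))) (toℕ<n t))
                      (at-toℕ y t))

    join-injective : ∀ {x y x′ y′} → join ℓ x y ≡ join ℓ x′ y′ → x ≡ x′ × y ≡ y′
    join-injective {x} {y} {x′} {y′} eq =
      trans (sym (front-join x y)) (trans (cong front eq) (front-join x′ y′)) ,
      trans (sym (back-join x y)) (trans (cong back eq) (back-join x′ y′))

    join-front-back : ∀ u → join ℓ (front u) (back u) ≡ u
    join-front-back u = vec-ext _ u letter
      where
      letter : ∀ t → lookup (join ℓ (front u) (back u)) t ≡ lookup u t
      letter t with toℕ t <? ℓ
      ... | yes t<ℓ = trans (lookup-join-front ℓ _ _ t t<ℓ)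
                            (trans (at-slice ℓ≤K u (toℕ t) t<ℓ) (at-toℕ u t))
      ... | no t≮ℓ = trans (lookup-join-back ℓ _ _ t ℓ≤t)
                           (trans (at-slice (back-fits ℓ≤K) u (toℕ t ∸ ℓ) (∸-monoˡ-< (toℕ<n t) ℓ≤t))
                                  (trans (at-cong u (m+[n∸m]≡n ℓ≤t) (toℕ<n t)) (at-toℕ u t)))
        where
        ℓ≤t : ℓ ≤ toℕ t
        ℓ≤t = ≮⇒≥ t≮ℓ

open Slices

module CycleOrbit {A : Set} (σ : A → A) (σ-bijective : IsBijection σ)
                  {Q : ℕ} .{{_ : NonZero Q}} (embed : Fin Q ↣ A)
                  (v : A) (reach : ∀ w → Σ ℕ λ j → j < Q × iter σ j v ≡ w) where

  σ⁻¹ : A → A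
  σ⁻¹ = proj₁ σ-bijective

  σ⁻¹-σ : ∀ x → σ⁻¹ (σ x) ≡ x
  σ⁻¹-σ = proj₁ (proj₂ σ-bijective)

  σ-σ⁻¹ : ∀ x → σ (σ⁻¹ x) ≡ x
  σ-σ⁻¹ = proj₂ (proj₂ σ-bijective)

  iter-injective : ∀ n {x y} → iter σ n x ≡ iter σ n y → x ≡ y
  iter-injective zero    eq = eq
  iter-injective (suc n) {x} {y} eq =
    iter-injective n (trans (sym (σ⁻¹-σ _)) (trans (cong σ⁻¹ eq) (σ⁻¹-σ _)))

  orbit : ℕ → A
  orbit j = iter σ j v

  orbit-periodic : ∀ d .{{_ : NonZero d}} → orbit d ≡ v → ∀ j → orbit j ≡ orbit (j % d)
  orbit-periodic d returns j = begin
    orbit j                            ≡⟨ cong orbit (m≡m%n+[m/n]*n j d) ⟩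
    orbit (j % d + j / d * d)          ≡⟨ iter-+ σ (j % d) (j / d * d) v ⟩
    iter σ (j % d) (orbit (j / d * d)) ≡⟨ cong (iter σ (j % d)) (multiples (j / d)) ⟩
    orbit (j % d)                      ∎
    where
    open ≡-Reasoning
    multiples : ∀ t → orbit (t * d) ≡ v
    multiples zero    = refl
    multiples (suc t) = trans (iter-+ σ d (t * d) v) (trans (cong (iter σ d) (multiples t)) returns)

  -- a positive return time d is at least Q: orbit 0, …, orbit (d-1) cover A
  return-time-≥ : ∀ d → 0 < d → orbit d ≡ v → Q ≤ d
  return-time-≥ (suc d) _ returns = injective⇒≤ {f = index} index-injective
    where
    time : Fin Q → ℕ
    time y = proj₁ (reach (Injection.to embed y))
    index : Fin Q → Fin (suc d)
    index y = fromℕ< (m%n<n (time y) (suc d))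
    orbit-index : ∀ y → orbit (toℕ (index y)) ≡ Injection.to embed y
    orbit-index y = trans (cong orbit (toℕ-fromℕ< (m%n<n (time y) (suc d))))
      (trans (sym (orbit-periodic (suc d) returns (time y))) (proj₂ (proj₂ (reach (Injection.to embed y)))))
    index-injective : Injective _≡_ _≡_ index
    index-injective {x} {y} eq = Injection.injective embed
      (trans (sym (orbit-index x)) (trans (cong (orbit ∘ toℕ) eq) (orbit-index y)))

  -- v = σ(σ⁻¹ v) is reached after j + 1 ≤ Q steps, so Q is a return time
  orbit-closes : orbit Q ≡ v
  orbit-closes with reach (σ⁻¹ v)
  ... | j , j<Q , reaches = subst (λ n → orbit n ≡ v) j+1≡Q returns
    where
    returns : orbit (suc j) ≡ v
    returns = trans (cong σ reaches) (σ-σ⁻¹ v)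
    j+1≡Q : suc j ≡ Q
    j+1≡Q = ≤-antisym j<Q (return-time-≥ (suc j) (s≤s z≤n) returns)

  orbit-mod : ∀ j → orbit j ≡ orbit (j % Q)
  orbit-mod = orbit-periodic Q orbit-closes

  -- orbit a = orbit b with a < b would be a return time b ∸ a < Q
  no-early-return : ∀ {a b} → a < b → b < Q → orbit a ≢ orbit b
  no-early-return {a} {b} a<b b<Q eq =
    <⇒≱ b<Q (≤-trans (return-time-≥ (b ∸ a) (m<n⇒0<n∸m a<b) returns) (m∸n≤m b a))
    where
    returns : orbit (b ∸ a) ≡ v
    returns = sym (iter-injective a
      (trans eq (trans (cong orbit (sym (m+[n∸m]≡n (<⇒≤ a<b)))) (iter-+ σ a (b ∸ a) v))))

  orbit-injective : ∀ {a b} → a < Q → b < Q → orbit a ≡ orbit b → a ≡ b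
  orbit-injective {a} {b} a<Q b<Q eq with <-cmp a b
  ... | tri≈ _ a≡b _ = a≡b
  ... | tri< a<b _ _ = ⊥-elim (no-early-return a<b b<Q eq)
  ... | tri> _ _ b<a = ⊥-elim (no-early-return b<a a<Q (sym eq))

module Necklace (p k : ℕ) (σ : Word (suc p) (suc k) → Word (suc p) (suc k))
                (v : Word (suc p) (suc k)) (cycle : IsCycle (suc p) (suc k) σ) where

  q K Q N : ℕ
  q = suc p
  K = suc k
  Q = q ^ K
  N = K * Q

  instance
    Q-nonZero : NonZero Q
    Q-nonZero = m^n≢0 q K
    N-nonZero : NonZero N
    N-nonZero = m*n≢0 K Q

  W : Set
  W = Word q K

  open Blocks K
  open CycleOrbit σ (proj₁ cycle) (words-embedding q K) v (proj₂ cycle v)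

  reach : ∀ w → Σ ℕ λ b → b < Q × orbit b ≡ w
  reach = proj₂ cycle v

  c : ℕ → Fin q
  c = cycleWord q K σ v

  c-block : ∀ b {j} (j<K : j < K) → c (b * K + j) ≡ at (orbit b) j j<K
  c-block b {j} j<K =
    trans (cong (λ n → at (orbit n) _ (m%n<n (b * K + j) K)) (block-quotient b j<K))
          (at-cong (orbit b) (block-remainder b j<K) j<K)

  reduced-block : ∀ j → j % N / K ≡ j / K % Q
  reduced-block j = helper N (*-comm K Q)
    where
    helper : ∀ M .{{_ : NonZero M}} → M ≡ Q * K → j % M / K ≡ j / K % Q
    helper .(Q * K) refl = m%[n*o]/o≡m/o%n j Q K {{_}} {{_}} {{m*n≢0 Q K}}

  reduced-offset : ∀ j → j % N % K ≡ j % K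
  reduced-offset j = m∣n⇒o%n%m≡o%m K N j (m∣m*n Q)

  c-periodic : ∀ j → c (j % N) ≡ c j
  c-periodic j = begin
    c (j % N)
      ≡⟨ cong (λ n → at (orbit n) _ (m%n<n (j % N) K)) (reduced-block j) ⟩
    at (orbit (j / K % Q)) (j % N % K) (m%n<n (j % N) K)
      ≡⟨ cong (λ w → at w _ (m%n<n (j % N) K)) (sym (orbit-mod (j / K))) ⟩
    at (orbit (j / K)) (j % N % K) (m%n<n (j % N) K)
      ≡⟨ at-cong (orbit (j / K)) (reduced-offset j) (m%n<n j K) ⟩
    c j ∎
    where open ≡-Reasoning

  window : ℕ → W
  window i = tabulate (λ t → c (i + toℕ t))

  lookup-window : ∀ i t → lookup (window i) t ≡ c (i + toℕ t)
  lookup-window i = lookup∘tabulate (λ t → c (i + toℕ t))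

  window-periodic : ∀ i → window (i % N) ≡ window i
  window-periodic i = tabulate-cong λ t → begin
    c (i % N + toℕ t)                  ≡⟨ sym (c-periodic _) ⟩
    c ((i % N + toℕ t) % N)            ≡⟨ cong c (%-distribˡ-+ (i % N) (toℕ t) N) ⟩
    c ((i % N % N + toℕ t % N) % N)    ≡⟨ cong (λ n → c ((n + toℕ t % N) % N)) (m%n%n≡m%n i N) ⟩
    c ((i % N + toℕ t % N) % N)        ≡⟨ cong c (sym (%-distribˡ-+ i (toℕ t) N)) ⟩
    c ((i + toℕ t) % N)                ≡⟨ c-periodic _ ⟩
    c (i + toℕ t)                      ∎
    where open ≡-Reasoning

  occurs⇔window : ∀ u i → OccursAt N c u i ⇔ window i ≡ u
  occurs⇔window u i = mk⇔
    (λ occ → vec-ext _ u λ t → trans (lookup-window i t) (trans (sym (c-periodic _)) (occ t)))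
    (λ eq t → trans (c-periodic _) (trans (sym (lookup-window i t)) (cong (λ w → lookup w t) eq)))

  block-mod-N : ∀ b {a} → a < K → (b * K + a) % N / K ≡ b % Q
  block-mod-N b {a} a<K = trans (reduced-block (b * K + a)) (cong (_% Q) (block-quotient b a<K))

  offset-mod-N : ∀ b {a} → a < K → (b * K + a) % N % K ≡ a
  offset-mod-N b {a} a<K = trans (reduced-offset (b * K + a)) (block-remainder b a<K)

  occurs-mod-N : ∀ {u} j → window j ≡ u → OccursAt N c u (j % N)
  occurs-mod-N {u} j occ = from (occurs⇔window u (j % N)) (trans (window-periodic j) occ)

  window-block : ∀ b → window (b * K + 0) ≡ orbit b
  window-block b = vec-ext _ (orbit b) λ t → begin
    lookup (window (b * K + 0)) t   ≡⟨ lookup-window (b * K + 0) t ⟩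
    c (b * K + 0 + toℕ t)           ≡⟨ cong (λ n → c (n + toℕ t)) (+-identityʳ (b * K)) ⟩
    c (b * K + toℕ t)               ≡⟨ c-block b (toℕ<n t) ⟩
    at (orbit b) (toℕ t) (toℕ<n t)  ≡⟨ at-toℕ (orbit b) t ⟩
    lookup (orbit b) t              ∎
    where open ≡-Reasoning

  window-straddle : ∀ {ℓ} (ℓ≤K : ℓ ≤ K) b →
    window (b * K + (K ∸ ℓ)) ≡ join ℓ (Cut.suffix ℓ≤K (orbit b)) (Cut.prefix ℓ≤K (orbit (suc b)))
  window-straddle {ℓ} ℓ≤K b = vec-ext _ _ letter
    where
    open ≡-Reasoning
    letter : ∀ t → lookup (window (b * K + (K ∸ ℓ))) t ≡ lookup (join ℓ _ _) t
    letter t with toℕ t <? ℓ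
    ... | yes t<ℓ = begin
      lookup (window (b * K + (K ∸ ℓ))) t     ≡⟨ lookup-window (b * K + (K ∸ ℓ)) t ⟩
      c (b * K + (K ∸ ℓ) + toℕ t)             ≡⟨ cong c (+-assoc (b * K) (K ∸ ℓ) (toℕ t)) ⟩
      c (b * K + (K ∸ ℓ + toℕ t))             ≡⟨ c-block b in-block ⟩
      at (orbit b) (K ∸ ℓ + toℕ t) in-block   ≡⟨ sym (at-slice (suffix-fits ℓ≤K) (orbit b) (toℕ t) t<ℓ) ⟩
      at (Cut.suffix ℓ≤K (orbit b)) (toℕ t) t<ℓ ≡⟨ sym (lookup-join-front ℓ _ _ t t<ℓ) ⟩
      lookup (join ℓ _ _) t                   ∎
      where
      in-block : K ∸ ℓ + toℕ t < K
      in-block = subst (K ∸ ℓ + toℕ t <_) (m∸n+n≡m ℓ≤K) (+-monoʳ-< (K ∸ ℓ) t<ℓ)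
    ... | no t≮ℓ = begin
      lookup (window (b * K + (K ∸ ℓ))) t     ≡⟨ lookup-window (b * K + (K ∸ ℓ)) t ⟩
      c (b * K + (K ∸ ℓ) + toℕ t)             ≡⟨ cong (λ n → c (b * K + (K ∸ ℓ) + n)) (sym (m+[n∸m]≡n ℓ≤t)) ⟩
      c (b * K + (K ∸ ℓ) + (ℓ + j))           ≡⟨ cong c (next-block b j ℓ≤K) ⟩
      c (suc b * K + j)                       ≡⟨ c-block (suc b) j<K ⟩
      at (orbit (suc b)) j j<K                ≡⟨ sym (at-slice (m∸n≤m K ℓ) (orbit (suc b)) j j<K∸ℓ) ⟩
      at (Cut.prefix ℓ≤K (orbit (suc b))) j j<K∸ℓ ≡⟨ sym (lookup-join-back ℓ _ _ t ℓ≤t) ⟩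
      lookup (join ℓ _ _) t                   ∎
      where
      ℓ≤t : ℓ ≤ toℕ t
      ℓ≤t = ≮⇒≥ t≮ℓ
      j : ℕ
      j = toℕ t ∸ ℓ
      j<K∸ℓ : j < K ∸ ℓ
      j<K∸ℓ = ∸-monoˡ-< (toℕ<n t) ℓ≤t
      j<K : j < K
      j<K = <-≤-trans j<K∸ℓ (m∸n≤m K ℓ)

  Match : (ℓ : ℕ) → Vec (Fin q) ℓ → Vec (Fin q) (K ∸ ℓ) → W → Set
  Match ℓ x y w = SuffixIs w x × PrefixIs (σ w) y

  match⇔window : ∀ {ℓ} (ℓ≤K : ℓ ≤ K) x y b →
                 Match ℓ x y (orbit b) ⇔ window (b * K + (K ∸ ℓ)) ≡ join ℓ x y
  match⇔window {ℓ} ℓ≤K x y b = mk⇔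
    (λ match → let (suffix≡x , prefix≡y) = to pieces match
               in trans (window-straddle ℓ≤K b) (cong₂ (join ℓ) suffix≡x prefix≡y))
    (λ eq → from pieces (Cut.join-injective ℓ≤K (trans (sym (window-straddle ℓ≤K b)) eq)))
    where
    pieces : Match ℓ x y (orbit b) ⇔ (Cut.suffix ℓ≤K (orbit b) ≡ x × Cut.prefix ℓ≤K (orbit (suc b)) ≡ y)
    pieces = ⇔-sym (slice≡⇔ (suffix-fits ℓ≤K) (orbit b) x ×-⇔ slice≡⇔ (m∸n≤m K ℓ) (orbit (suc b)) y)

  UniqueInClass : W → ℕ → Set
  UniqueInClass u a = Σ ℕ λ b → b < Q × window (b * K + a) ≡ u
                              × (∀ b′ → window (b′ * K + a) ≡ u → orbit b′ ≡ orbit b)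

  AllClasses : Set
  AllClasses = ∀ u a → a < K → UniqueInClass u a

  Condition : Set
  Condition = ∀ ℓ → ℓ < K → (x : Vec (Fin q) ℓ) (y : Vec (Fin q) (K ∸ ℓ)) → ∃!′ W (Match ℓ x y)

  Perfect : Set
  Perfect = KKPerfect q K N c

  -- class 0 holds for every cycle: the windows there are the words σ^b(v)
  class-0 : ∀ u → UniqueInClass u 0
  class-0 u with reach u
  ... | b , b<Q , orbit-b≡u = b , b<Q , trans (window-block b) orbit-b≡u ,
        λ b′ occ′ → trans (sym (window-block b′)) (trans occ′ (sym orbit-b≡u))

  -- the case ℓ = 0 of the condition holds for every bijection: w = σ⁻¹(y)
  condition-0 : ∀ x y → ∃!′ W (Match 0 x y)
  condition-0 x y = σ⁻¹ y , ((λ ()) , has-prefix) , unique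
    where
    has-prefix : PrefixIs (σ (σ⁻¹ y)) y
    has-prefix t lt = trans (cong (λ w → at w (toℕ t) lt) (σ-σ⁻¹ y)) (at-toℕ y t)
    unique : ∀ w → Match 0 x y w → w ≡ σ⁻¹ y
    unique w (_ , prefix) = trans (sym (σ⁻¹-σ w)) (cong σ⁻¹ (vec-ext (σ w) y λ t →
      trans (sym (at-toℕ (σ w) t)) (prefix t (toℕ<n t))))

  -- class K ∸ ℓ from the condition at ℓ: split u = x y and take the unique w = σ^b(v)
  condition⇒class : Condition → ∀ {ℓ} → ℓ < K → ∀ u → UniqueInClass u (K ∸ ℓ)
  condition⇒class condition {ℓ} ℓ<K u = b , b<Q , occurs , unique
    where
    ℓ≤K : ℓ ≤ K
    ℓ≤K = <⇒≤ ℓ<K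
    x : Vec (Fin q) ℓ
    x = Cut.front ℓ≤K u
    y : Vec (Fin q) (K ∸ ℓ)
    y = Cut.back ℓ≤K u
    w : W
    w = proj₁ (condition ℓ ℓ<K x y)
    match : Match ℓ x y w
    match = proj₁ (proj₂ (condition ℓ ℓ<K x y))
    w-unique : ∀ w′ → Match ℓ x y w′ → w′ ≡ w
    w-unique = proj₂ (proj₂ (condition ℓ ℓ<K x y))
    b : ℕ
    b = proj₁ (reach w)
    b<Q : b < Q
    b<Q = proj₁ (proj₂ (reach w))
    orbit-b≡w : orbit b ≡ w
    orbit-b≡w = proj₂ (proj₂ (reach w))
    occurs : window (b * K + (K ∸ ℓ)) ≡ u
    occurs = trans (to (match⇔window ℓ≤K x y b) (subst (Match ℓ x y) (sym orbit-b≡w) match))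
                   (Cut.join-front-back ℓ≤K u)
    unique : ∀ b′ → window (b′ * K + (K ∸ ℓ)) ≡ u → orbit b′ ≡ orbit b
    unique b′ occ′ = trans (w-unique (orbit b′) (from (match⇔window ℓ≤K x y b′)
                                       (trans occ′ (sym (Cut.join-front-back ℓ≤K u)))))
                           (sym orbit-b≡w)

  -- the condition at ℓ from class K ∸ ℓ: w = σ^b(v) for the block b of x y
  class⇒condition : ∀ {ℓ} → ℓ ≤ K → (∀ u → UniqueInClass u (K ∸ ℓ)) → ∀ x y → ∃!′ W (Match ℓ x y)
  class⇒condition {ℓ} ℓ≤K class x y with class (join ℓ x y)
  ... | b , _ , occurs , b-unique = orbit b , from (match⇔window ℓ≤K x y b) occurs , unique
    where
    unique : ∀ w → Match ℓ x y w → w ≡ orbit b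
    unique w match with reach w
    ... | b′ , _ , orbit-b′≡w = trans (sym orbit-b′≡w)
          (b-unique b′ (to (match⇔window ℓ≤K x y b′) (subst (Match ℓ x y) (sym orbit-b′≡w) match)))

  -- class a ≠ 0 is class K ∸ ℓ for ℓ = K ∸ a < K; class 0 always holds
  condition⇒classes : Condition → AllClasses
  condition⇒classes condition u zero    _   = class-0 u
  condition⇒classes condition u (suc a) a<K =
    subst (UniqueInClass u) (m∸[m∸n]≡n (<⇒≤ a<K)) (condition⇒class condition (s≤s (m∸n≤m k a)) u)

  -- ℓ ≠ 0 uses class K ∸ ℓ < K; ℓ = 0 always holds
  classes⇒condition : AllClasses → Condition
  classes⇒condition classes zero    _   = condition-0
  classes⇒condition classes (suc ℓ) ℓ<K =
    class⇒condition (<⇒≤ ℓ<K) (λ u → classes u (K ∸ suc ℓ) (s≤s (m∸n≤m k ℓ)))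

  -- the k occurrences, one per residue class, listed by their residues
  classes⇒perfect : AllClasses → Perfect
  classes⇒perfect classes u = position , occurs , distinct , complete
    where
    class : (a : Fin K) → UniqueInClass u (toℕ a)
    class a = classes u (toℕ a) (toℕ<n a)
    block : Fin K → ℕ
    block a = proj₁ (class a)
    position : Fin K → Fin N
    position a = fromℕ< (position-bound (proj₁ (proj₂ (class a))) (toℕ<n a))
    toℕ-position : ∀ a → toℕ (position a) ≡ block a * K + toℕ a
    toℕ-position a = toℕ-fromℕ< _
    occurs : ∀ a → OccursAt N c u (toℕ (position a))
    occurs a = from (occurs⇔window u _)
      (subst (λ i → window i ≡ u) (sym (toℕ-position a)) (proj₁ (proj₂ (proj₂ (class a)))))
    residue : ∀ a → toℕ (position a) % K ≡ toℕ a
    residue a = trans (cong (_% K) (toℕ-position a)) (block-remainder (block a) (toℕ<n a))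
    distinct : ∀ a a′ → a ≢ a′ → toℕ (position a) % K ≢ toℕ (position a′) % K
    distinct a a′ a≢a′ eq = a≢a′ (toℕ-injective (trans (sym (residue a)) (trans eq (residue a′))))
    complete : ∀ i → OccursAt N c u (toℕ i) → Σ (Fin K) λ a → position a ≡ i
    complete i occ = a , toℕ-injective (trans (toℕ-position a)
                            (trans (cong (λ b → b * K + toℕ a) (sym same-block)) (sym i-split)))
      where
      a : Fin K
      a = fromℕ< (m%n<n (toℕ i) K)
      i-split : toℕ i ≡ toℕ i / K * K + toℕ a
      i-split = trans (div-mod-split (toℕ i)) (cong (toℕ i / K * K +_) (sym (toℕ-fromℕ< _)))
      same-block : toℕ i / K ≡ block a
      same-block = orbit-injective (block-bound (toℕ<n i)) (proj₁ (proj₂ (class a)))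
        (proj₂ (proj₂ (proj₂ (class a))) (toℕ i / K)
          (subst (λ j → window j ≡ u) i-split (to (occurs⇔window u (toℕ i)) occ)))

  -- the listed occurrence with residue a gives the block b; any occurrence in
  -- class a reduces mod N to a listed one with residue a, hence to that one
  perfect⇒classes : Perfect → AllClasses
  perfect⇒classes perfect u a a<K with perfect u
  ... | position , occurs , distinct , complete = b , b<Q , occurs-in-class , unique
    where
    open Residues K (toℕ ∘ position) distinct
    a₀ : Fin K
    a₀ = proj₁ (residue-cover a<K)
    i b : ℕ
    i = toℕ (position a₀)
    b = i / K
    b<Q : b < Q
    b<Q = block-bound (toℕ<n (position a₀))
    i-split : i ≡ b * K + a
    i-split = trans (div-mod-split i) (cong (b * K +_) (proj₂ (residue-cover a<K)))
    occurs-in-class : window (b * K + a) ≡ u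
    occurs-in-class = subst (λ j → window j ≡ u) i-split (to (occurs⇔window u i) (occurs a₀))
    unique : ∀ b′ → window (b′ * K + a) ≡ u → orbit b′ ≡ orbit b
    unique b′ occ′ = trans (orbit-mod b′) (cong orbit (begin
      b′ % Q    ≡⟨ sym (block-mod-N b′ a<K) ⟩
      j % N / K ≡⟨ cong (_/ K) j%N≡i ⟩
      i / K     ∎))
      where
      open ≡-Reasoning
      j : ℕ
      j = b′ * K + a
      j%N<N : j % N < N
      j%N<N = m%n<n j N
      listed : Σ (Fin K) λ x → position x ≡ fromℕ< j%N<N
      listed = complete (fromℕ< j%N<N)
        (subst (OccursAt N c u) (sym (toℕ-fromℕ< j%N<N)) (occurs-mod-N j occ′))
      listed-position : toℕ (position (proj₁ listed)) ≡ j % N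
      listed-position = trans (cong toℕ (proj₂ listed)) (toℕ-fromℕ< j%N<N)
      j%N≡i : j % N ≡ i
      j%N≡i = trans (sym listed-position) (cong (toℕ ∘ position) (residue-injective
        (trans (cong (_% K) listed-position) (trans (offset-mod-N b′ a<K) (sym (proj₂ (residue-cover a<K)))))))

lemma2p2 : (p k : ℕ) → (σ : Word (suc p) (suc k) → Word (suc p) (suc k)) → (v : Word (suc p) (suc k)) →
    IsCycle (suc p) (suc k) σ →
    PerfectNecklaceOfCycle p k σ v
      ⇔ (∀ (ℓ : ℕ) → ℓ < suc k → (x : Vec (Fin (suc p)) ℓ) → (y : Vec (Fin (suc p)) (suc k ∸ ℓ)) →
           ∃!′ (Word (suc p) (suc k)) (λ w → SuffixIs w x × PrefixIs (σ w) y))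
lemma2p2 p k σ v cycle =
  mk⇔ (classes⇒condition ∘ perfect⇒classes) (classes⇒perfect ∘ condition⇒classes)
  where open Necklace p k σ v cycle
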